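{- Fix integers $p\ge 1$ and $q\ge 2$. For each integer $n\ge 1$, let $$\mathcal{K}_{n,p,q} := \{A\subset\{1,\ldots,n\} : \text{either } A=\emptyset \text{ or } (\max A - \max_2 A = p \text{ and } \min A\ge |A|\ge q)\}.$$ Then for all $n\ge 1$, $$|\mathcal{K}_{n,p,q}| = \begin{cases} 1 & \text{if } 1\le n\le p+2q-3,\\ |\mathcal{K}_{n-1,p,q}| + |\mathcal{K}_{n-2,p,q}| + \binom{n-p-q}{q-2} - 1 & \text{if } n> p+2q-3.\end{cases}$$
   Context: For a finite set $A$ of positive integers with $|A|\ge 2$, $\max_2 A$ denotes the second largest element of $A$. $|A|$ denotes the cardinality of $A$. -}

module Defs where

open import Data.Nat using (ℕ; zero; suc; _≤_; _∸_)
open import Data.Nat.Properties using (_≤?_; _≟_)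
open import Data.List using (List; []; _∷_; map; length; filter; _++_)
open import Data.Vec using ([]; _∷_)
open import Data.Fin.Subset using (Subset; inside; outside)
open import Relation.Binary.PropositionalEquality using (_≡_)
open import Data.Product using (_×_)
open import Data.Unit using (⊤)
open import Relation.Nullary using (Dec; yes)
open import Relation.Nullary.Decidable using (_×-dec_)

-- All subsets of {1,…,n} (a Subset n marks position i : Fin n, standing for the integer toℕ i + 1).
allSubsets : (n : ℕ) → List (Subset n)
allSubsets zero = [] ∷ []
allSubsets (suc n) = map (inside ∷_) (allSubsets n) ++ map (outside ∷_) (allSubsets n)

elems : {n : ℕ} → Subset n → List ℕ
elems [] = []
elems (inside ∷ s) = 1 ∷ map suc (elems s)
elems (outside ∷ s) = map suc (elems s)

-- For an increasing list with at least two entries: (largest) ∸ (second largest),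
-- i.e. max A - max₂ A.  (Value 0 on shorter lists; only used when length ≥ 2.)
topGap : List ℕ → ℕ
topGap (x ∷ y ∷ []) = y ∸ x
topGap (x ∷ y ∷ z ∷ r) = topGap (y ∷ z ∷ r)
topGap _ = 0

KCond : (p q : ℕ) → List ℕ → Set
KCond p q [] = ⊤
KCond p q (m ∷ xs) =
  (topGap (m ∷ xs) ≡ p) × (length (m ∷ xs) ≤ m) × (q ≤ length (m ∷ xs))

KCond? : (p q : ℕ) (xs : List ℕ) → Dec (KCond p q xs)
KCond? p q [] = yes _
KCond? p q (m ∷ xs) = (topGap (m ∷ xs) ≟ p) ×-dec ((length (m ∷ xs) ≤? m) ×-dec (q ≤? length (m ∷ xs)))

InK : (n p q : ℕ) → Subset n → Set
InK n p q A = KCond p q (elems A)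

cardK : (n p q : ℕ) → ℕ
cardK n p q = length (filter (λ A → KCond? p q (elems A)) (allSubsets n))

{-# OPTIONS --safe #-}
module Submission where

-- A nonempty A ∈ 𝒦_{n,p,q} is B ∪ {max B + p} for a set B ⊆ {1,…,n-p} with
-- |B| ≥ q-1 and min B > |B|, so |𝒦_{n,p,q}| = 1 + G(n-p), where G(N) counts
-- such B ⊆ {1,…,N}.  Those B with N ∉ B are counted by G(N-1).  If N ∈ B, then
-- B = (B' + 1) ∪ {N} with B' ⊆ {1,…,N-2}, |B'| ≥ q-2 and min B' > |B'|: the B'
-- with |B'| > q-2 are counted by G(N-2), and those with |B'| = q-2 are the
-- (q-2)-subsets of {q-1,…,N-2}, of which there are C(N-q, q-2).  Hence
-- G(N) = G(N-1) + G(N-2) + C(N-q, q-2), while G(N) = 0 for N ≤ 2q-3, since a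
-- k-set with minimum above k lies in {k+1,…,N}.

open import Defs
open import Data.Nat using (ℕ; zero; suc; _+_; _*_; _∸_; _≤_; _<_; z≤n; s≤s; s≤s⁻¹; z<s)
open import Data.Nat.Properties
open import Data.Nat.Combinatorics using (_C_; nCk+nC[k+1]≡[n+1]C[k+1]; k>n⇒nCk≡0)
open import Data.Nat.Tactic.RingSolver using (solve-∀)
open import Algebra.Properties.CommutativeSemigroup +-commutativeSemigroup using (interchange)
open import Data.Bool using (true; false)
open import Data.List using (List; []; _∷_; [_]; map; length; filter; _++_)
open import Data.List.Properties using (map-++; length-map; length-++; filter-++)
open import Data.List.Relation.Unary.All using (All; []; _∷_)
open import Data.Vec using (_∷_)
open import Data.Fin.Subset using (inside; outside)
open import Data.Product using (_×_; _,_; proj₁; proj₂)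
open import Data.Sum using (_⊎_; inj₁; inj₂; [_,_]′)
open import Data.Empty using (⊥-elim)
open import Function using (_∘_)
open import Relation.Nullary using (Dec; yes; no; does; ¬_)
open import Relation.Nullary.Decidable using (_×-dec_)
open import Relation.Unary using (Decidable)
open import Relation.Binary.PropositionalEquality hiding ([_])
open ≡-Reasoning

𝟙 : {P : Set} → Dec P → ℕ
𝟙 (yes _) = 1
𝟙 (no _)  = 0

𝟙-cong : {P Q : Set} (P? : Dec P) (Q? : Dec Q) → (P → Q) → (Q → P) → 𝟙 P? ≡ 𝟙 Q?
𝟙-cong (yes _) (yes _)  _ _ = refl
𝟙-cong (yes p) (no ¬q)  f _ = ⊥-elim (¬q (f p))
𝟙-cong (no ¬p) (yes q)  _ g = ⊥-elim (¬p (g q))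
𝟙-cong (no _)  (no _)   _ _ = refl

𝟙-yes : {P : Set} (P? : Dec P) → P → 𝟙 P? ≡ 1
𝟙-yes (yes _) _ = refl
𝟙-yes (no ¬p) p = ⊥-elim (¬p p)

𝟙-no : {P : Set} (P? : Dec P) → ¬ P → 𝟙 P? ≡ 0
𝟙-no (yes p) ¬p = ⊥-elim (¬p p)
𝟙-no (no _)  _  = refl

𝟙-×-dec : {P Q : Set} (P? : Dec P) (Q? : Dec Q) → 𝟙 (P? ×-dec Q?) ≡ 𝟙 P? * 𝟙 Q?
𝟙-×-dec (yes _) (yes _) = refl
𝟙-×-dec (yes _) (no _)  = refl
𝟙-×-dec (no _)  (yes _) = refl
𝟙-×-dec (no _)  (no _)  = refl

𝟙-⊎ : {P Q R : Set} (P? : Dec P) (Q? : Dec Q) (R? : Dec R) →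
  (P → Q ⊎ R) → (Q ⊎ R → P) → (Q → ¬ R) → 𝟙 P? ≡ 𝟙 Q? + 𝟙 R?
𝟙-⊎ (yes _)  (yes q)  (yes r)  _ _ disjoint = ⊥-elim (disjoint q r)
𝟙-⊎ (yes _)  (yes _)  (no _)   _ _ _        = refl
𝟙-⊎ (yes _)  (no _)   (yes _)  _ _ _        = refl
𝟙-⊎ (yes p)  (no ¬q)  (no ¬r)  f _ _        = ⊥-elim ([ ¬q , ¬r ]′ (f p))
𝟙-⊎ (no ¬p)  (yes q)  _        _ g _        = ⊥-elim (¬p (g (inj₁ q)))
𝟙-⊎ (no ¬p)  (no _)   (yes r)  _ g _        = ⊥-elim (¬p (g (inj₂ r)))
𝟙-⊎ (no _)   (no _)   (no _)   _ _ _        = refl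

Σ⊆ : ℕ → (List ℕ → ℕ) → ℕ
Σ⊆ zero    w = w []
Σ⊆ (suc n) w = Σ⊆ n (λ xs → w (1 ∷ map suc xs)) + Σ⊆ n (λ xs → w (map suc xs))

length-filter-map : {A B : Set} {P : B → Set} (P? : Decidable P) (f : A → B) (xs : List A) →
  length (filter P? (map f xs)) ≡ length (filter (P? ∘ f) xs)
length-filter-map P? f [] = refl
length-filter-map P? f (x ∷ xs) with does (P? (f x))
... | true  = cong suc (length-filter-map P? f xs)
... | false = length-filter-map P? f xs

length-filter-allSubsets : ∀ n {P : List ℕ → Set} (P? : Decidable P) →
  length (filter (P? ∘ elems) (allSubsets n)) ≡ Σ⊆ n (𝟙 ∘ P?)
length-filter-allSubsets zero P? with P? []
... | yes _ = refl
... | no _  = refl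
length-filter-allSubsets (suc n) P? = begin
  length (filter Q? (map (inside ∷_) S ++ map (outside ∷_) S))
    ≡⟨ cong length (filter-++ Q? (map (inside ∷_) S) (map (outside ∷_) S)) ⟩
  length (filter Q? (map (inside ∷_) S) ++ filter Q? (map (outside ∷_) S))
    ≡⟨ length-++ (filter Q? (map (inside ∷_) S)) ⟩
  length (filter Q? (map (inside ∷_) S)) + length (filter Q? (map (outside ∷_) S))
    ≡⟨ cong₂ _+_ (length-filter-map Q? (inside ∷_) S) (length-filter-map Q? (outside ∷_) S) ⟩
  length (filter (Q? ∘ (inside ∷_)) S) + length (filter (Q? ∘ (outside ∷_)) S)
    ≡⟨ cong₂ _+_ (length-filter-allSubsets n (P? ∘ (1 ∷_) ∘ map suc))
                 (length-filter-allSubsets n (P? ∘ map suc)) ⟩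
  Σ⊆ (suc n) (𝟙 ∘ P?) ∎
  where
  S = allSubsets n
  Q? = P? ∘ elems

InRange : ℕ → List ℕ → Set
InRange n = All (λ x → 1 ≤ x × x ≤ n)

InRange-map-suc : ∀ {n} xs → InRange n xs → InRange (suc n) (map suc xs)
InRange-map-suc []       []                = []
InRange-map-suc (x ∷ xs) ((_ , x≤n) ∷ rest) = (s≤s z≤n , s≤s x≤n) ∷ InRange-map-suc xs rest

Σ⊆-cong-InRange : ∀ n {w v : List ℕ → ℕ} →
  (∀ xs → InRange n xs → w xs ≡ v xs) → Σ⊆ n w ≡ Σ⊆ n v
Σ⊆-cong-InRange zero    eq = eq [] []
Σ⊆-cong-InRange (suc n) eq = cong₂ _+_
  (Σ⊆-cong-InRange n λ xs r → eq (1 ∷ map suc xs) ((s≤s z≤n , s≤s z≤n) ∷ InRange-map-suc xs r))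
  (Σ⊆-cong-InRange n λ xs r → eq (map suc xs) (InRange-map-suc xs r))

Σ⊆-cong : ∀ n {w v : List ℕ → ℕ} → (∀ xs → w xs ≡ v xs) → Σ⊆ n w ≡ Σ⊆ n v
Σ⊆-cong n eq = Σ⊆-cong-InRange n (λ xs _ → eq xs)

Σ⊆-const-0 : ∀ n → Σ⊆ n (λ _ → 0) ≡ 0
Σ⊆-const-0 zero    = refl
Σ⊆-const-0 (suc n) = cong₂ _+_ (Σ⊆-const-0 n) (Σ⊆-const-0 n)

Σ⊆-zero : ∀ n {w : List ℕ → ℕ} → (∀ xs → InRange n xs → w xs ≡ 0) → Σ⊆ n w ≡ 0
Σ⊆-zero n vanish = trans (Σ⊆-cong-InRange n vanish) (Σ⊆-const-0 n)

Σ⊆-+ : ∀ n (w v : List ℕ → ℕ) → Σ⊆ n (λ xs → w xs + v xs) ≡ Σ⊆ n w + Σ⊆ n v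
Σ⊆-+ zero    w v = refl
Σ⊆-+ (suc n) w v =
  trans (cong₂ _+_ (Σ⊆-+ n (w ∘ (1 ∷_) ∘ map suc) (v ∘ (1 ∷_) ∘ map suc))
                   (Σ⊆-+ n (w ∘ map suc) (v ∘ map suc)))
        (interchange (Σ⊆ n (w ∘ (1 ∷_) ∘ map suc)) (Σ⊆ n (v ∘ (1 ∷_) ∘ map suc))
                     (Σ⊆ n (w ∘ map suc)) (Σ⊆ n (v ∘ map suc)))

Σ⊆-suc : ∀ n (w : List ℕ → ℕ) → Σ⊆ (suc n) w ≡ Σ⊆ n (λ xs → w (xs ++ [ suc n ])) + Σ⊆ n w
Σ⊆-suc zero    w = refl
Σ⊆-suc (suc n) w = begin
  Σ⊆ (suc n) w₁ + Σ⊆ (suc n) w₀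
    ≡⟨ cong₂ _+_ (Σ⊆-suc n w₁) (Σ⊆-suc n w₀) ⟩
  (Σ⊆ n (λ xs → w₁ (xs ++ [ suc n ])) + Σ⊆ n w₁) +
  (Σ⊆ n (λ xs → w₀ (xs ++ [ suc n ])) + Σ⊆ n w₀)
    ≡⟨ interchange (Σ⊆ n (λ xs → w₁ (xs ++ [ suc n ]))) (Σ⊆ n w₁)
                   (Σ⊆ n (λ xs → w₀ (xs ++ [ suc n ]))) (Σ⊆ n w₀) ⟩
  (Σ⊆ n (λ xs → w₁ (xs ++ [ suc n ])) + Σ⊆ n (λ xs → w₀ (xs ++ [ suc n ]))) + Σ⊆ (suc n) w
    ≡⟨ cong (_+ Σ⊆ (suc n) w) (cong₂ _+_
         (Σ⊆-cong n λ xs → cong (w ∘ (1 ∷_)) (map-++ suc xs [ suc n ]))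
         (Σ⊆-cong n λ xs → cong w (map-++ suc xs [ suc n ]))) ⟩
  Σ⊆ (suc n) (λ xs → w (xs ++ [ suc (suc n) ])) + Σ⊆ (suc n) w ∎
  where
  w₁ w₀ : List ℕ → ℕ
  w₁ xs = w (1 ∷ map suc xs)
  w₀ xs = w (map suc xs)

hasSize : ℕ → List ℕ → ℕ
hasSize r xs = 𝟙 (length xs ≟ r)

hasSize-map-suc : ∀ r xs → hasSize r (map suc xs) ≡ hasSize r xs
hasSize-map-suc r xs = cong (λ k → 𝟙 (k ≟ r)) (length-map suc xs)

Σ⊆-hasSize : ∀ N r → Σ⊆ N (hasSize r) ≡ N C r
Σ⊆-hasSize zero    zero    = refl
Σ⊆-hasSize zero    (suc r) = refl
Σ⊆-hasSize (suc N) zero    =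
  cong₂ _+_ (Σ⊆-const-0 N) (trans (Σ⊆-cong N (hasSize-map-suc 0)) (Σ⊆-hasSize N 0))
Σ⊆-hasSize (suc N) (suc r) = begin
  Σ⊆ N (hasSize (suc r) ∘ (1 ∷_) ∘ map suc) + Σ⊆ N (hasSize (suc r) ∘ map suc)
    ≡⟨ cong₂ _+_ (Σ⊆-cong N λ xs → trans (dropHead (map suc xs)) (hasSize-map-suc r xs))
                 (Σ⊆-cong N (hasSize-map-suc (suc r))) ⟩
  Σ⊆ N (hasSize r) + Σ⊆ N (hasSize (suc r))
    ≡⟨ cong₂ _+_ (Σ⊆-hasSize N r) (Σ⊆-hasSize N (suc r)) ⟩
  N C r + N C suc r
    ≡⟨ nCk+nC[k+1]≡[n+1]C[k+1] N r ⟩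
  suc N C suc r ∎
  where
  dropHead : ∀ xs → hasSize (suc r) (1 ∷ xs) ≡ hasSize r xs
  dropHead xs = 𝟙-cong (suc (length xs) ≟ suc r) (length xs ≟ r) suc-injective (cong suc)

sizeMinAbove : ℕ → ℕ → List ℕ → ℕ
sizeMinAbove r t []       = 𝟙 (0 ≟ r)
sizeMinAbove r t (x ∷ xs) = 𝟙 ((suc (length xs) ≟ r) ×-dec (t <? x))

sizeMinAbove-map-suc : ∀ r t xs → sizeMinAbove r (suc t) (map suc xs) ≡ sizeMinAbove r t xs
sizeMinAbove-map-suc r t []       = refl
sizeMinAbove-map-suc r t (x ∷ xs) =
  𝟙-cong ((suc (length (map suc xs)) ≟ r) ×-dec (suc t <? suc x)) ((suc (length xs) ≟ r) ×-dec (t <? x))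
    (λ { (e , s≤s t<x) → trans (cong suc (sym (length-map suc xs))) e , t<x })
    (λ { (e , t<x) → trans (cong suc (length-map suc xs)) e , s≤s t<x })

Σ⊆-sizeMinAbove : ∀ t N r → Σ⊆ N (sizeMinAbove r t) ≡ (N ∸ t) C r
Σ⊆-sizeMinAbove zero N r = trans (Σ⊆-cong-InRange N positive) (Σ⊆-hasSize N r)
  where
  positive : ∀ xs → InRange N xs → sizeMinAbove r 0 xs ≡ hasSize r xs
  positive []       _              = refl
  positive (x ∷ xs) ((1≤x , _) ∷ _) =
    𝟙-cong ((suc (length xs) ≟ r) ×-dec (0 <? x)) (suc (length xs) ≟ r) proj₁ (_, 1≤x)
Σ⊆-sizeMinAbove (suc t) zero    zero    = refl
Σ⊆-sizeMinAbove (suc t) zero    (suc r) = refl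
Σ⊆-sizeMinAbove (suc t) (suc N) r       = cong₂ _+_
  (Σ⊆-zero N λ xs _ → 𝟙-no ((suc (length (map suc xs)) ≟ r) ×-dec (suc t <? 1)) (λ { (_ , s≤s ()) }))
  (trans (Σ⊆-cong N (sizeMinAbove-map-suc r t)) (Σ⊆-sizeMinAbove t N r))

-- sparse s B = 𝟙[|B| ≥ s and min B > |B|]; the G(N) above is Σ⊆ N (sparse (q ∸ 1)).
sparse : ℕ → List ℕ → ℕ
sparse s []       = 𝟙 (s ≟ 0)
sparse s (x ∷ xs) = 𝟙 ((s ≤? suc (length xs)) ×-dec (suc (length xs) <? x))

sparse-split : ∀ r xs → sparse r xs ≡ sparse (suc r) xs + sizeMinAbove r r xs
sparse-split zero    [] = refl
sparse-split (suc r) [] = refl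
sparse-split r (x ∷ xs) =
  𝟙-⊎ ((r ≤? L) ×-dec (L <? x)) ((suc r ≤? L) ×-dec (L <? x)) ((L ≟ r) ×-dec (r <? x))
    (λ { (r≤L , L<x) → [ (λ r<L → inj₁ (r<L , L<x)) , (λ { refl → inj₂ (refl , L<x) }) ]′
                         (m≤n⇒m<n∨m≡n r≤L) })
    [ (λ { (r<L , L<x) → <⇒≤ r<L , L<x }) , (λ { (refl , r<x) → ≤-refl , r<x }) ]′
    (λ { (r<L , _) (L≡r , _) → <⇒≢ r<L (sym L≡r) })
  where
  L = suc (length xs)

length-map-suc-snoc : ∀ xs z → length (map suc xs ++ [ z ]) ≡ suc (length xs)
length-map-suc-snoc xs z = begin
  length (map suc xs ++ [ z ]) ≡⟨ length-++ (map suc xs) ⟩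
  length (map suc xs) + 1      ≡⟨ +-comm _ 1 ⟩
  suc (length (map suc xs))    ≡⟨ cong suc (length-map suc xs) ⟩
  suc (length xs)              ∎

sparse-shift : ∀ r z xs → sparse (suc r) (map suc xs ++ [ suc (suc z) ]) ≡ sparse r xs
sparse-shift r z [] =
  𝟙-cong ((suc r ≤? 1) ×-dec (1 <? suc (suc z))) (r ≟ 0)
    (λ { (s≤s r≤0 , _) → n≤0⇒n≡0 r≤0 }) (λ { refl → ≤-refl , s≤s (s≤s z≤n) })
sparse-shift r z (x ∷ xs) rewrite length-map-suc-snoc xs (suc (suc z)) =
  𝟙-cong ((suc r ≤? suc (suc (length xs))) ×-dec (suc (suc (length xs)) <? suc x))
         ((r ≤? suc (length xs)) ×-dec (suc (length xs) <? x))
    (λ { (s≤s r≤L , s≤s L<x) → r≤L , L<x }) (λ { (r≤L , L<x) → s≤s r≤L , s≤s L<x })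

Σ⊆-sparse-rec : ∀ r M →
  Σ⊆ (suc (suc M)) (sparse (suc r)) ≡
  Σ⊆ (suc M) (sparse (suc r)) + Σ⊆ M (sparse (suc r)) + (M ∸ r) C r
Σ⊆-sparse-rec r M = begin
  Σ⊆ (suc (suc M)) G
    ≡⟨ Σ⊆-suc (suc M) G ⟩
  Σ⊆ M (λ xs → G (1 ∷ map suc xs ++ [ suc (suc M) ])) +
  Σ⊆ M (λ xs → G (map suc xs ++ [ suc (suc M) ])) + Σ⊆ (suc M) G
    ≡⟨ cong (_+ Σ⊆ (suc M) G) (cong₂ _+_ containingOne (Σ⊆-cong M (sparse-shift r M))) ⟩
  0 + Σ⊆ M (sparse r) + Σ⊆ (suc M) G
    ≡⟨ cong (_+ Σ⊆ (suc M) G) (Σ⊆-cong M (sparse-split r)) ⟩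
  Σ⊆ M (λ xs → G xs + sizeMinAbove r r xs) + Σ⊆ (suc M) G
    ≡⟨ cong (_+ Σ⊆ (suc M) G) (trans (Σ⊆-+ M G (sizeMinAbove r r))
                                      (cong (Σ⊆ M G +_) (Σ⊆-sizeMinAbove r M r))) ⟩
  Σ⊆ M G + (M ∸ r) C r + Σ⊆ (suc M) G
    ≡⟨ +-comm _ (Σ⊆ (suc M) G) ⟩
  Σ⊆ (suc M) G + (Σ⊆ M G + (M ∸ r) C r)
    ≡⟨ +-assoc (Σ⊆ (suc M) G) _ _ ⟨
  Σ⊆ (suc M) G + Σ⊆ M G + (M ∸ r) C r ∎
  where
  G = sparse (suc r)
  containingOne : Σ⊆ M (λ xs → G (1 ∷ map suc xs ++ [ suc (suc M) ])) ≡ 0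
  containingOne = Σ⊆-zero M λ xs _ →
    𝟙-no ((suc r ≤? suc (length (map suc xs ++ [ suc (suc M) ]))) ×-dec
          (suc (length (map suc xs ++ [ suc (suc M) ])) <? 1))
         (λ { (_ , s≤s ()) })

m<n+n⇒m∸n<n : ∀ {m n} → m < n + n → m ∸ n < n
m<n+n⇒m∸n<n {m} {suc n} m<n+n = m<n+o⇒m∸n<o m (suc n) m<n+n

Σ⊆-sparse-small : ∀ r N → N ≤ suc (r + r) → Σ⊆ N (sparse (suc r)) ≡ 0
Σ⊆-sparse-small r zero          _ = refl
Σ⊆-sparse-small r (suc zero)    _ =
  trans (+-identityʳ _) (𝟙-no ((suc r ≤? 1) ×-dec (1 <? 1)) (λ { (_ , s≤s ()) }))
Σ⊆-sparse-small r (suc (suc M)) (s≤s 1+M≤r+r) = begin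
  Σ⊆ (suc (suc M)) G                  ≡⟨ Σ⊆-sparse-rec r M ⟩
  Σ⊆ (suc M) G + Σ⊆ M G + (M ∸ r) C r
    ≡⟨ cong₂ _+_ (cong₂ _+_ (Σ⊆-sparse-small r (suc M) 1+M≤1+r+r) (Σ⊆-sparse-small r M M≤1+r+r))
                 (k>n⇒nCk≡0 (m<n+n⇒m∸n<n {n = r} 1+M≤r+r)) ⟩
  0                                   ∎
  where
  G = sparse (suc r)
  1+M≤1+r+r = m≤n⇒m≤1+n 1+M≤r+r
  M≤1+r+r = ≤-trans (n≤1+n M) 1+M≤1+r+r

last₀ : List ℕ → ℕ
last₀ []           = 0
last₀ (x ∷ [])     = x
last₀ (x ∷ y ∷ ys) = last₀ (y ∷ ys)

last₀-snoc : ∀ xs z → last₀ (xs ++ [ z ]) ≡ z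
last₀-snoc []           z = refl
last₀-snoc (x ∷ [])     z = refl
last₀-snoc (x ∷ y ∷ ys) z = last₀-snoc (y ∷ ys) z

All-last₀ : {P : ℕ → Set} (x : ℕ) (xs : List ℕ) → All P (x ∷ xs) → P (last₀ (x ∷ xs))
All-last₀ x []       (px ∷ []) = px
All-last₀ x (y ∷ ys) (_ ∷ all) = All-last₀ y ys all

last₀≤ : ∀ {n} xs → InRange n xs → last₀ xs ≤ n
last₀≤ []       _     = z≤n
last₀≤ (x ∷ xs) range = proj₂ (All-last₀ x xs range)

topGap-snoc : ∀ x xs z → topGap (x ∷ xs ++ [ z ]) ≡ z ∸ last₀ (x ∷ xs)
topGap-snoc x []           z = refl
topGap-snoc x (y ∷ [])     z = refl
topGap-snoc x (y ∷ w ∷ ws) z = topGap-snoc y (w ∷ ws) z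

inK : ℕ → ℕ → List ℕ → ℕ
inK p q = 𝟙 ∘ KCond? p q

inK-snoc : ∀ p' r n xs → InRange n xs →
  inK (suc p') (suc (suc r)) (xs ++ [ suc n ]) ≡ 𝟙 (last₀ xs + suc p' ≟ suc n) * sparse (suc r) xs
inK-snoc p' r n [] _ = sym (*-zeroʳ (𝟙 (suc p' ≟ suc n)))
inK-snoc p' r n (x ∷ xs) range =
  trans (𝟙-cong (KCond? (suc p') (suc (suc r)) (x ∷ xs ++ [ suc n ]))
                ((l + suc p' ≟ suc n) ×-dec ((suc r ≤? suc L) ×-dec (suc L <? x)))
                to from)
        (𝟙-×-dec (l + suc p' ≟ suc n) ((suc r ≤? suc L) ×-dec (suc L <? x)))
  where
  l = last₀ (x ∷ xs)
  L = length xs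
  l≤1+n : l ≤ suc n
  l≤1+n = m≤n⇒m≤1+n (last₀≤ (x ∷ xs) range)
  gap : topGap (x ∷ xs ++ [ suc n ]) ≡ suc n ∸ l
  gap = topGap-snoc x xs (suc n)
  size : length (x ∷ xs ++ [ suc n ]) ≡ suc (suc L)
  size = cong suc (trans (length-++ xs) (+-comm L 1))
  to : KCond (suc p') (suc (suc r)) (x ∷ xs ++ [ suc n ]) →
       (l + suc p' ≡ suc n) × (suc r ≤ suc L) × (suc L < x)
  to (gap≡p , size≤x , q≤size) =
    trans (cong (l +_) (trans (sym gap≡p) gap)) (m+[n∸m]≡n l≤1+n) ,
    s≤s⁻¹ (subst (suc (suc r) ≤_) size q≤size) ,
    subst (_≤ x) size size≤x
  from : (l + suc p' ≡ suc n) × (suc r ≤ suc L) × (suc L < x) →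
         KCond (suc p') (suc (suc r)) (x ∷ xs ++ [ suc n ])
  from (l+p≡1+n , r≤L , L<x) =
    trans gap (trans (cong (_∸ l) (sym l+p≡1+n)) (m+n∸m≡n l (suc p'))) ,
    subst (_≤ x) (sym size) L<x ,
    subst (suc (suc r) ≤_) (sym size) (s≤s r≤L)

endingAt : ℕ → (List ℕ → ℕ) → List ℕ → ℕ
endingAt m Q xs = 𝟙 (last₀ xs ≟ m) * Q xs

Σ⊆-endingAt : ∀ {m N} → m < N → (Q : List ℕ → ℕ) →
  Σ⊆ N (endingAt (suc m) Q) ≡ Σ⊆ m (λ ys → Q (ys ++ [ suc m ]))
Σ⊆-endingAt {m} {suc N} m<1+N Q with m<1+n⇒m<n∨m≡n m<1+N
... | inj₂ refl = begin
  Σ⊆ (suc m) W                               ≡⟨ Σ⊆-suc m W ⟩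
  Σ⊆ m (λ ys → W (ys ++ [ suc m ])) + Σ⊆ m W ≡⟨ cong₂ _+_ (Σ⊆-cong m hit) (Σ⊆-zero m miss) ⟩
  Σ⊆ m (λ ys → Q (ys ++ [ suc m ])) + 0      ≡⟨ +-identityʳ _ ⟩
  Σ⊆ m (λ ys → Q (ys ++ [ suc m ]))          ∎
  where
  W = endingAt (suc m) Q
  hit : ∀ ys → W (ys ++ [ suc m ]) ≡ Q (ys ++ [ suc m ])
  hit ys = trans (cong (_* Q (ys ++ [ suc m ]))
                       (𝟙-yes (last₀ (ys ++ [ suc m ]) ≟ suc m) (last₀-snoc ys (suc m))))
                 (*-identityˡ _)
  miss : ∀ xs → InRange m xs → W xs ≡ 0
  miss xs range = cong (_* Q xs) (𝟙-no (last₀ xs ≟ suc m)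
    λ last≡1+m → 1+n≰n (subst (_≤ m) last≡1+m (last₀≤ xs range)))
... | inj₁ m<N =
  trans (Σ⊆-suc N W) (cong₂ _+_ (Σ⊆-zero N (λ xs _ → miss xs)) (Σ⊆-endingAt m<N Q))
  where
  W = endingAt (suc m) Q
  miss : ∀ xs → W (xs ++ [ suc N ]) ≡ 0
  miss xs = cong (_* Q (xs ++ [ suc N ])) (𝟙-no (last₀ (xs ++ [ suc N ]) ≟ suc m)
    λ last≡1+m → <⇒≢ m<N (suc-injective (trans (sym last≡1+m) (last₀-snoc xs (suc N)))))

Σ⊆-inK-small : ∀ p' r n → n ≤ suc p' → Σ⊆ n (inK (suc p') (suc (suc r))) ≡ 1
Σ⊆-inK-small p' r zero    _          = refl
Σ⊆-inK-small p' r (suc n) (s≤s n≤p') =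
  trans (Σ⊆-suc n K) (cong₂ _+_ (Σ⊆-zero n tooEarly) (Σ⊆-inK-small p' r n (m≤n⇒m≤1+n n≤p')))
  where
  K = inK (suc p') (suc (suc r))
  tooEarly : ∀ xs → InRange n xs → K (xs ++ [ suc n ]) ≡ 0
  tooEarly []       _     = refl
  tooEarly (x ∷ xs) range =
    trans (inK-snoc p' r n (x ∷ xs) range)
          (cong (_* sparse (suc r) (x ∷ xs)) (𝟙-no (l + suc p' ≟ suc n) l+p≢1+n))
    where
    l = last₀ (x ∷ xs)
    2+p≤l+p : 2 + p' ≤ l + suc p'
    2+p≤l+p = +-monoˡ-≤ (suc p') (proj₁ (All-last₀ x xs range))
    l+p≢1+n : l + suc p' ≢ suc n
    l+p≢1+n l+p≡1+n = 1+n≰n (≤-trans (subst (2 + p' ≤_) l+p≡1+n 2+p≤l+p) (s≤s n≤p'))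

Σ⊆-inK-large : ∀ p' r m → Σ⊆ (m + suc p') (inK (suc p') (suc (suc r))) ≡ suc (Σ⊆ m (sparse (suc r)))
Σ⊆-inK-large p' r zero    = Σ⊆-inK-small p' r (suc p') ≤-refl
Σ⊆-inK-large p' r (suc m) = begin
  Σ⊆ (suc m + suc p') K
    ≡⟨ Σ⊆-suc N K ⟩
  Σ⊆ N (λ xs → K (xs ++ [ suc N ])) + Σ⊆ N K
    ≡⟨ cong₂ _+_ (Σ⊆-cong-InRange N maxAt) (Σ⊆-inK-large p' r m) ⟩
  Σ⊆ N (endingAt (suc m) G) + suc (Σ⊆ m G)
    ≡⟨ cong (_+ suc (Σ⊆ m G)) (Σ⊆-endingAt (m<m+n m z<s) G) ⟩
  Σ⊆ m (λ ys → G (ys ++ [ suc m ])) + suc (Σ⊆ m G)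
    ≡⟨ +-suc _ _ ⟩
  suc (Σ⊆ m (λ ys → G (ys ++ [ suc m ])) + Σ⊆ m G)
    ≡⟨ cong suc (Σ⊆-suc m G) ⟨
  suc (Σ⊆ (suc m) G) ∎
  where
  K = inK (suc p') (suc (suc r))
  G = sparse (suc r)
  N = m + suc p'
  maxAt : ∀ xs → InRange N xs → K (xs ++ [ suc N ]) ≡ endingAt (suc m) G xs
  maxAt xs range = trans (inK-snoc p' r N xs range) (cong (_* G xs)
    (𝟙-cong (last₀ xs + suc p' ≟ suc N) (last₀ xs ≟ suc m)
            (+-cancelʳ-≡ (suc p') (last₀ xs) (suc m)) (cong (_+ suc p'))))

cardK≡ : ∀ p' r n → cardK n (suc p') (suc (suc r)) ≡ suc (Σ⊆ (n ∸ suc p') (sparse (suc r)))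
cardK≡ p' r n = trans (length-filter-allSubsets n (KCond? p q)) (byCase (≤-total n p))
  where
  p = suc p'
  q = suc (suc r)
  G = sparse (suc r)
  byCase : n ≤ p ⊎ p ≤ n → Σ⊆ n (inK p q) ≡ suc (Σ⊆ (n ∸ p) G)
  byCase (inj₁ n≤p) = begin
    Σ⊆ n (inK p q)              ≡⟨ Σ⊆-inK-small p' r n n≤p ⟩
    suc (Σ⊆ 0 G)                ≡⟨ cong (λ k → suc (Σ⊆ k G)) (m≤n⇒m∸n≡0 n≤p) ⟨
    suc (Σ⊆ (n ∸ p) G)          ∎
  byCase (inj₂ p≤n) = begin
    Σ⊆ n (inK p q)              ≡⟨ cong (λ k → Σ⊆ k (inK p q)) (m∸n+n≡m p≤n) ⟨
    Σ⊆ (n ∸ p + p) (inK p q)    ≡⟨ Σ⊆-inK-large p' r (n ∸ p) ⟩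
    suc (Σ⊆ (n ∸ p) G)          ∎

∸-comm : ∀ m a b → m ∸ a ∸ b ≡ m ∸ b ∸ a
∸-comm m a b = begin
  m ∸ a ∸ b   ≡⟨ ∸-+-assoc m a b ⟩
  m ∸ (a + b) ≡⟨ cong (m ∸_) (+-comm a b) ⟩
  m ∸ (b + a) ≡⟨ ∸-+-assoc m b a ⟨
  m ∸ b ∸ a   ∎

threshold≡ : ∀ p' r → suc p' + 2 * suc (suc r) ∸ 3 ≡ suc p' + suc (r + r)
threshold≡ p' r = trans (cong (_∸ 3) (expand p' r)) (m+n∸m≡n 3 _)
  where
  expand : ∀ p' r → suc p' + 2 * suc (suc r) ≡ 3 + (suc p' + suc (r + r))
  expand = solve-∀

suc-Σ⊆-sparse-rec : ∀ r N → 2 ≤ N →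
  suc (Σ⊆ N (sparse (suc r))) + 1 ≡
  suc (Σ⊆ (N ∸ 1) (sparse (suc r))) + suc (Σ⊆ (N ∸ 2) (sparse (suc r))) + (N ∸ suc (suc r)) C r
suc-Σ⊆-sparse-rec r (suc (suc M)) (s≤s (s≤s z≤n)) =
  trans (cong (λ g → suc g + 1) (Σ⊆-sparse-rec r M)) (shuffle _ _ ((M ∸ r) C r))
  where
  shuffle : ∀ a b c → suc (a + b + c) + 1 ≡ suc a + suc b + c
  shuffle = solve-∀

theorem3 : (p q : ℕ) → 1 ≤ p → 2 ≤ q → (n : ℕ) → 1 ≤ n →
    ((n ≤ p + 2 * q ∸ 3 → cardK n p q ≡ 1) ×
     (p + 2 * q ∸ 3 < n →
       cardK n p q + 1 ≡ cardK (n ∸ 1) p q + cardK (n ∸ 2) p q + ((n ∸ p ∸ q) C (q ∸ 2))))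
theorem3 p@(suc p') q@(suc (suc r)) (s≤s z≤n) (s≤s (s≤s z≤n)) n _ = belowThreshold , aboveThreshold
  where
  G : ℕ → ℕ
  G N = Σ⊆ N (sparse (suc r))

  belowThreshold : n ≤ p + 2 * q ∸ 3 → cardK n p q ≡ 1
  belowThreshold n≤ = trans (cardK≡ p' r n) (cong suc (Σ⊆-sparse-small r (n ∸ p)
    (subst (n ∸ p ≤_) (m+n∸m≡n p _) (∸-monoˡ-≤ p (subst (n ≤_) (threshold≡ p' r) n≤)))))

  cardK-pred : ∀ k → cardK (n ∸ k) p q ≡ suc (G (n ∸ p ∸ k))
  cardK-pred k = trans (cardK≡ p' r (n ∸ k)) (cong (suc ∘ G) (∸-comm n k p))

  aboveThreshold : p + 2 * q ∸ 3 < n →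
    cardK n p q + 1 ≡ cardK (n ∸ 1) p q + cardK (n ∸ 2) p q + ((n ∸ p ∸ q) C (q ∸ 2))
  aboveThreshold <n = begin
    cardK n p q + 1                                              ≡⟨ cong (_+ 1) (cardK≡ p' r n) ⟩
    suc (G (n ∸ p)) + 1                                          ≡⟨ suc-Σ⊆-sparse-rec r (n ∸ p) 2≤n∸p ⟩
    suc (G (n ∸ p ∸ 1)) + suc (G (n ∸ p ∸ 2)) + (n ∸ p ∸ q) C r
      ≡⟨ cong₂ (λ a b → a + b + (n ∸ p ∸ q) C r) (cardK-pred 1) (cardK-pred 2) ⟨
    cardK (n ∸ 1) p q + cardK (n ∸ 2) p q + (n ∸ p ∸ q) C r      ∎
    where
    2≤n∸p : 2 ≤ n ∸ p
    2≤n∸p = ≤-trans (s≤s (s≤s z≤n)) (subst (_< n ∸ p) (m+n∸m≡n p _)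
      (∸-monoˡ-< (subst (_< n) (threshold≡ p' r) <n) (m≤m+n p _)))
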